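{- Let $\varphi,\psi$ be propositional formulas with $\varphi\wedge\psi\models\bot$, let $\sigma\subseteq\mathrm{sig}(\varphi)$, and let $\varphi'$ and $\psi'$ be conservative extensions of $\varphi$ and $\psi$, respectively, such that every atom occurring in both $\varphi'$ and $\psi'$ occurs in both $\varphi$ and $\psi$. Then every uniform $\sigma$-interpolant for $\varphi'$ is also a uniform $\sigma$-interpolant for $\varphi$, and every Craig separator for $\varphi',\psi'$ is also a Craig separator for $\varphi,\psi$.
   Context: Propositional formulas are built from atoms using $\top,\bot,\neg,\wedge,\vee$; $\models$ is classical entailment and $\mathrm{sig}(\varphi)$ is the set of atoms of $\varphi$. A $\tau$-formula is a formula $\chi$ with $\mathrm{sig}(\chi)\subseteq\tau$. A formula $\psi$ is a conservative extension of $\varphi$ if $\psi\models\varphi$, $\mathrm{sig}(\varphi)\subseteq\mathrm{sig}(\psi)$, and for every $\mathrm{sig}(\varphi)$-formula $\chi$, $\psi\models\chi$ implies $\varphi\models\chi$. For $\sigma\subseteq\mathrm{sig}(\varphi)$, a uniform $\sigma$-interpolant for $\varphi$ is a formula $\chi$ with $\varphi\models\chi$, $\mathrm{sig}(\chi)\subseteq\sigma$, and such that $\chi\models\psi$ for every formula $\psi$ with $\varphi\models\psi$ and $\mathrm{sig}(\psi)\cap\mathrm{sig}(\varphi)\subseteq\sigma$. A Craig separator for $\varphi,\psi$ is a formula $\chi$ with $\varphi\models\chi$, $\chi\wedge\psi\models\bot$, and $\mathrm{sig}(\chi)\subseteq\mathrm{sig}(\varphi)\cap\mathrm{sig}(\psi)$.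 -}

module Defs where

open import Data.Nat using (ℕ)
open import Data.Bool using (Bool; true; false; not; _∧_; _∨_)
open import Data.Product using (_×_)
open import Data.Sum using (_⊎_)
open import Relation.Binary.PropositionalEquality using (_≡_)

Atom : Set
Atom = ℕ

data Form : Set where
  atom : Atom → Form
  ⊤'   : Form
  ⊥'   : Form
  ¬'_  : Form → Form
  _∧'_ : Form → Form → Form
  _∨'_ : Form → Form → Form

Valuation : Set
Valuation = Atom → Bool

eval : Valuation → Form → Bool
eval v (atom a) = v a
eval v ⊤'       = true
eval v ⊥'       = false
eval v (¬' φ)   = not (eval v φ)
eval v (φ ∧' ψ) = eval v φ ∧ eval v ψ
eval v (φ ∨' ψ) = eval v φ ∨ eval v ψ

_⊨_ : Form → Form → Set
φ ⊨ ψ = (v : Valuation) → eval v φ ≡ true → eval v ψ ≡ true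

data sig : Form → Atom → Set where
  s-atom : ∀ {a} → sig (atom a) a
  s-¬    : ∀ {φ a} → sig φ a → sig (¬' φ) a
  s-∧ˡ   : ∀ {φ ψ a} → sig φ a → sig (φ ∧' ψ) a
  s-∧ʳ   : ∀ {φ ψ a} → sig ψ a → sig (φ ∧' ψ) a
  s-∨ˡ   : ∀ {φ ψ a} → sig φ a → sig (φ ∨' ψ) a
  s-∨ʳ   : ∀ {φ ψ a} → sig ψ a → sig (φ ∨' ψ) a

Sig : Set₁
Sig = Atom → Set

_⊆_ : Sig → Sig → Set
σ ⊆ τ = ∀ a → σ a → τ a

IsSigFormula : Sig → Form → Set
IsSigFormula τ χ = sig χ ⊆ τ

ConservativeExtension : Form → Form → Set
ConservativeExtension ψ φ =
  (ψ ⊨ φ) × (sig φ ⊆ sig ψ) ×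
  ((χ : Form) → IsSigFormula (sig φ) χ → ψ ⊨ χ → φ ⊨ χ)

-- χ is a uniform σ-interpolant for φ (for σ ⊆ sig φ, assumed separately).
UniformInterpolant : Sig → Form → Form → Set
UniformInterpolant σ φ χ =
  (φ ⊨ χ) × (sig χ ⊆ σ) ×
  ((ψ : Form) → φ ⊨ ψ → (∀ a → sig ψ a → sig φ a → σ a) → χ ⊨ ψ)

CraigSeparator : Form → Form → Form → Set
CraigSeparator φ ψ χ =
  (φ ⊨ χ) × ((χ ∧' ψ) ⊨ ⊥') × (∀ a → sig χ a → sig φ a × sig ψ a)

{-# OPTIONS --safe #-}
module Submission where

-- A Craig separator χ of φ′, ψ′ only uses atoms shared by φ and ψ, so
-- conservativity carries φ′ ⊨ χ down to φ and ψ′ ⊨ ¬χ down to ψ.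
-- For a uniform σ-interpolant χ of φ′, a consequence θ of φ that χ must entail
-- may mention atoms of φ′ outside sig φ, so χ's property does not apply to it
-- directly. Instead fix a model v of χ and pin every atom of θ outside sig φ to
-- its value under v: the pinned formula is still a consequence of φ (which
-- cannot see those atoms), hence of φ′, and it shares only atoms of σ with φ′,
-- so χ entails it; at v it has the same value as θ.

open import Defs
open import Data.Bool using (Bool; true; false; not; _∧_; _∨_)
open import Data.Empty using (⊥-elim)
open import Data.Nat using (_≟_)
open import Data.Product using (_×_; _,_; proj₁; proj₂; map₁)
open import Relation.Nullary using (yes; no; ¬_)
open import Relation.Unary using (Decidable)
open import Relation.Binary.PropositionalEquality using (_≡_; refl; sym; trans; cong; cong₂)

∧⊨⊥⇒⊨¬ : ∀ {χ ψ} → (χ ∧' ψ) ⊨ ⊥' → ψ ⊨ (¬' χ)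
∧⊨⊥⇒⊨¬ {χ} χ∧ψ⊨⊥ v ψv with eval v χ | χ∧ψ⊨⊥ v
... | true  | ⊥-if-ψ = ⊥-if-ψ ψv
... | false | _      = refl

⊨¬⇒∧⊨⊥ : ∀ {χ ψ} → ψ ⊨ (¬' χ) → (χ ∧' ψ) ⊨ ⊥'
⊨¬⇒∧⊨⊥ {χ} ψ⊨¬χ v χ∧ψ with eval v χ | ψ⊨¬χ v
... | true  | ¬χ-if-ψ = ¬χ-if-ψ χ∧ψ
... | false | _       = χ∧ψ

eval-cong : ∀ {u w} φ → (∀ a → sig φ a → u a ≡ w a) → eval u φ ≡ eval w φ
eval-cong (atom a) u≗w = u≗w a s-atom
eval-cong ⊤'       u≗w = refl
eval-cong ⊥'       u≗w = refl
eval-cong (¬' φ)   u≗w = cong not (eval-cong φ (λ a s → u≗w a (s-¬ s)))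
eval-cong (φ ∧' ψ) u≗w =
  cong₂ _∧_ (eval-cong φ (λ a s → u≗w a (s-∧ˡ s))) (eval-cong ψ (λ a s → u≗w a (s-∧ʳ s)))
eval-cong (φ ∨' ψ) u≗w =
  cong₂ _∨_ (eval-cong φ (λ a s → u≗w a (s-∨ˡ s))) (eval-cong ψ (λ a s → u≗w a (s-∨ʳ s)))

sig? : ∀ φ → Decidable (sig φ)
sig? (atom a) b with a ≟ b
... | yes refl = yes s-atom
... | no a≢b   = no λ { s-atom → a≢b refl }
sig? ⊤'       b = no λ ()
sig? ⊥'       b = no λ ()
sig? (¬' φ)   b with sig? φ b
... | yes s = yes (s-¬ s)
... | no ¬s = no λ { (s-¬ s) → ¬s s }
sig? (φ ∧' ψ) b with sig? φ b | sig? ψ b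
... | yes s | _     = yes (s-∧ˡ s)
... | no _  | yes s = yes (s-∧ʳ s)
... | no ¬s | no ¬t = no λ { (s-∧ˡ s) → ¬s s ; (s-∧ʳ t) → ¬t t }
sig? (φ ∨' ψ) b with sig? φ b | sig? ψ b
... | yes s | _     = yes (s-∨ˡ s)
... | no _  | yes s = yes (s-∨ʳ s)
... | no ¬s | no ¬t = no λ { (s-∨ˡ s) → ¬s s ; (s-∨ʳ t) → ¬t t }

fromBool : Bool → Form
fromBool true  = ⊤'
fromBool false = ⊥'

eval-fromBool : ∀ v b → eval v (fromBool b) ≡ b
eval-fromBool v true  = refl
eval-fromBool v false = refl

sig-fromBool : ∀ b a → ¬ sig (fromBool b) a
sig-fromBool true  a ()
sig-fromBool false a ()

module Pin {τ : Sig} (τ? : Decidable τ) (v : Valuation) where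

  override : Valuation → Valuation
  override u a with τ? a
  ... | yes _ = u a
  ... | no _  = v a

  pinAtom : Atom → Form
  pinAtom a with τ? a
  ... | yes _ = atom a
  ... | no _  = fromBool (v a)

  pin : Form → Form
  pin (atom a) = pinAtom a
  pin ⊤'       = ⊤'
  pin ⊥'       = ⊥'
  pin (¬' ψ)   = ¬' pin ψ
  pin (ψ ∧' χ) = pin ψ ∧' pin χ
  pin (ψ ∨' χ) = pin ψ ∨' pin χ

  override-∈ : ∀ u {a} → τ a → override u a ≡ u a
  override-∈ u {a} a∈τ with τ? a
  ... | yes _   = refl
  ... | no a∉τ = ⊥-elim (a∉τ a∈τ)

  override-self : ∀ a → override v a ≡ v a
  override-self a with τ? a
  ... | yes _ = refl
  ... | no _  = refl

  eval-pinAtom : ∀ u a → eval u (pinAtom a) ≡ override u a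
  eval-pinAtom u a with τ? a
  ... | yes _ = refl
  ... | no _  = eval-fromBool u (v a)

  eval-pin : ∀ u ψ → eval u (pin ψ) ≡ eval (override u) ψ
  eval-pin u (atom a) = eval-pinAtom u a
  eval-pin u ⊤'       = refl
  eval-pin u ⊥'       = refl
  eval-pin u (¬' ψ)   = cong not (eval-pin u ψ)
  eval-pin u (ψ ∧' χ) = cong₂ _∧_ (eval-pin u ψ) (eval-pin u χ)
  eval-pin u (ψ ∨' χ) = cong₂ _∨_ (eval-pin u ψ) (eval-pin u χ)

  sig-pinAtom : ∀ a {b} → sig (pinAtom a) b → sig (atom a) b × τ b
  sig-pinAtom a s with τ? a
  sig-pinAtom a s-atom | yes a∈τ = s-atom , a∈τ
  sig-pinAtom a s      | no _    = ⊥-elim (sig-fromBool (v a) _ s)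

  sig-pin : ∀ ψ {b} → sig (pin ψ) b → sig ψ b × τ b
  sig-pin (atom a) s        = sig-pinAtom a s
  sig-pin (¬' ψ)   (s-¬ s)  = map₁ s-¬ (sig-pin ψ s)
  sig-pin (ψ ∧' χ) (s-∧ˡ s) = map₁ s-∧ˡ (sig-pin ψ s)
  sig-pin (ψ ∧' χ) (s-∧ʳ s) = map₁ s-∧ʳ (sig-pin χ s)
  sig-pin (ψ ∨' χ) (s-∨ˡ s) = map₁ s-∨ˡ (sig-pin ψ s)
  sig-pin (ψ ∨' χ) (s-∨ʳ s) = map₁ s-∨ʳ (sig-pin χ s)

  eval-pin-self : ∀ ψ → eval v (pin ψ) ≡ eval v ψ
  eval-pin-self ψ = trans (eval-pin v ψ) (eval-cong ψ (λ a _ → override-self a))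

  ⊨-pin : ∀ {φ ψ} → sig φ ⊆ τ → φ ⊨ ψ → φ ⊨ pin ψ
  ⊨-pin {φ} {ψ} sigφ⊆τ φ⊨ψ u φu = trans (eval-pin u ψ) (φ⊨ψ (override u) φ-override)
    where
    φ-override : eval (override u) φ ≡ true
    φ-override = trans (eval-cong φ (λ a s → override-∈ u (sigφ⊆τ a s))) φu

uniformInterpolant-conservative : ∀ {σ φ φ′ χ}
  → σ ⊆ sig φ
  → ConservativeExtension φ′ φ
  → UniformInterpolant σ φ′ χ
  → UniformInterpolant σ φ χ
uniformInterpolant-conservative {σ} {φ} {φ′} {χ} σ⊆sigφ (φ′⊨φ , _ , conservative)
  (φ′⊨χ , sigχ⊆σ , uniform) =
  conservative χ (λ a s → σ⊆sigφ a (sigχ⊆σ a s)) φ′⊨χ , sigχ⊆σ , χ⊨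
  where
  χ⊨ : (θ : Form) → φ ⊨ θ → (∀ a → sig θ a → sig φ a → σ a) → χ ⊨ θ
  χ⊨ θ φ⊨θ shared⊆σ v χv = trans (sym (eval-pin-self θ)) (χ⊨pinθ v χv)
    where
    open Pin (sig? φ) v
    φ′⊨pinθ : φ′ ⊨ pin θ
    φ′⊨pinθ u φ′u = ⊨-pin {φ} {θ} (λ _ s → s) φ⊨θ u (φ′⊨φ u φ′u)

    χ⊨pinθ : χ ⊨ pin θ
    χ⊨pinθ = uniform (pin θ) φ′⊨pinθ (λ a s _ → let (sθ , sφ) = sig-pin θ s in shared⊆σ a sθ sφ)

craigSeparator-conservative : ∀ {φ ψ φ′ ψ′ χ}
  → ConservativeExtension φ′ φ
  → ConservativeExtension ψ′ ψ
  → (∀ a → sig φ′ a → sig ψ′ a → sig φ a × sig ψ a)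
  → CraigSeparator φ′ ψ′ χ
  → CraigSeparator φ ψ χ
craigSeparator-conservative {φ} {ψ} {ψ′ = ψ′} {χ} (_ , _ , conservativeφ) (_ , _ , conservativeψ) shared
  (φ′⊨χ , χ∧ψ′⊨⊥ , sigχ⊆shared′) =
  φ⊨χ , ⊨¬⇒∧⊨⊥ {χ} {ψ} ψ⊨¬χ , sigχ⊆shared
  where
  sigχ⊆shared : ∀ a → sig χ a → sig φ a × sig ψ a
  sigχ⊆shared a s = let (s′ , t′) = sigχ⊆shared′ a s in shared a s′ t′

  φ⊨χ : φ ⊨ χ
  φ⊨χ = conservativeφ χ (λ a s → proj₁ (sigχ⊆shared a s)) φ′⊨χ

  ψ⊨¬χ : ψ ⊨ (¬' χ)
  ψ⊨¬χ = conservativeψ (¬' χ) (λ { a (s-¬ s) → proj₂ (sigχ⊆shared a s) }) (∧⊨⊥⇒⊨¬ {χ} {ψ′} χ∧ψ′⊨⊥)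

-- φ ∧ ψ ⊨ ⊥ is needed only for separators of φ, ψ to exist, not for either transfer.
mainTheorem8 : (φ ψ φ′ ψ′ : Form) (σ : Sig)
    → (φ ∧' ψ) ⊨ ⊥'
    → σ ⊆ sig φ
    → ConservativeExtension φ′ φ
    → ConservativeExtension ψ′ ψ
    → (∀ a → sig φ′ a → sig ψ′ a → sig φ a × sig ψ a)
    → ((χ : Form) → UniformInterpolant σ φ′ χ → UniformInterpolant σ φ χ)
      × ((χ : Form) → CraigSeparator φ′ ψ′ χ → CraigSeparator φ ψ χ)
mainTheorem8 φ ψ φ′ ψ′ σ _ σ⊆sigφ φ′-conservative ψ′-conservative shared =
  (λ _ → uniformInterpolant-conservative σ⊆sigφ φ′-conservative) ,
  (λ _ → craigSeparator-conservative φ′-conservative ψ′-conservative shared)
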